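{- Let $p=2$ and $r\ge0$. Then minimal polynomial expressions of $\operatorname{argmax}^{(r)}$ are given as follows: (1) $\operatorname{argmax}^{(r)}(x_0)=0$. (2) If $n$ and $k\ge0$ are integers with $2^{r+1}k+2^r\le n<2^{r+1}(k+1)$, then \[ \operatorname{argmax}^{(r)}(x_0,x_1,\dots,x_n)=\sum_{j=0}^{k}\ \sum_{i=0}^{\min(2^r-1,\,n-2^{r+1}j-2^r)}(1+x_0)(1+x_1)\cdots(1+x_{2^{r+1}j+2^r+i-1})\,x_{2^{r+1}j+2^r+i}. \] (3) If $n\ge1$ and $k\ge0$ are integers with $2^{r+1}k\le n<2^{r+1}k+2^r$, then \[ \operatorname{argmax}^{(r)}(x_0,x_1,\dots,x_n)=\operatorname{argmax}^{(r)}(x_0,x_1,\dots,x_{n-1}). \]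
   Context: $\mathbb{F}_2$ is identified with $\{0,1\}$ with the usual ordering. For $x=(x_0,\dots,x_{m-1})\in\mathbb{F}_2{}^m$, $\operatorname{argmax}(x)$ is the least index $i$ with $x_i=\max(x_0,\dots,x_{m-1})$, and $\operatorname{argmax}^{(r)}(x)\in\mathbb{F}_2$ is the $r$-th binary digit of $\operatorname{argmax}(x)$. A minimal polynomial expression is a polynomial over $\mathbb{F}_2$ of degree at most $1$ in each variable coinciding with the function on all inputs. -}

module Defs where

open import Data.Bool using (Bool; true; false; _∧_; _∨_; _xor_; not; if_then_else_)
open import Data.Nat using (ℕ; zero; suc; _<?_; _^_; _/_; _%_)
open import Data.Fin using (Fin; fromℕ<)
import Data.Fin as F
open import Relation.Nullary using (yes; no)

-- 𝔽₂ is modelled by Bool: false = 0, true = 1, addition = xor,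
-- multiplication = ∧, and the order 0 < 1 is false < true.

maxF2 : ∀ {m} → (Fin m → Bool) → Bool
maxF2 {zero}  x = false
maxF2 {suc m} x = x F.zero ∨ maxF2 (λ i → x (F.suc i))

_==_ : Bool → Bool → Bool
a == b = not (a xor b)

-- least index i < m with P i = true (returns m if there is none)
leastIdx : ∀ {m} → (Fin m → Bool) → ℕ
leastIdx {zero}  P = zero
leastIdx {suc m} P = if P F.zero then zero else suc (leastIdx (λ i → P (F.suc i)))

argmax : ∀ {m} → (Fin m → Bool) → ℕ
argmax x = leastIdx (λ i → x i == maxF2 x)

digit : ℕ → ℕ → Bool
digit zero    a = if (a % 2) Data.Nat.≡ᵇ 1 then true else false
digit (suc r) a = digit r (a / 2)

argmaxDigit : ℕ → ∀ {m} → (Fin m → Bool) → Bool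
argmaxDigit r x = digit r (argmax x)

-- the variable x_i (i given as a natural number); out-of-range indices give 0
-- (they never occur in the statement under its hypotheses)
var : ∀ {m} → (Fin m → Bool) → ℕ → Bool
var {m} x i with i <? m
... | yes p = x (fromℕ< p)
... | no _  = false

sumF2 : ℕ → (ℕ → Bool) → Bool
sumF2 zero    f = false
sumF2 (suc N) f = sumF2 N f xor f N

prodF2 : ℕ → (ℕ → Bool) → Bool
prodF2 zero    f = true
prodF2 (suc N) f = prodF2 N f ∧ f N

-- The summand (1 + x₀)⋯(1 + x_{t−1}) x_t equals 1 exactly when x ≠ 0 and
-- t = argmax x.  The indices t of the double sum in (2) are the numbers ≤ n
-- of the form 2^(r+1) j + 2^r + i with i < 2^r, i.e. those whose r-th
-- binary digit is 1; since argmax x ≤ n, the sum is that digit of argmax x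
-- (and both sides vanish for x = 0, where argmax x = 0).  In (3), removing
-- x_n changes argmax x only when argmax x = n, and then both digits are 0
-- because the r-th digit of n is 0.

module Submission where

open import Defs
open import Data.Bool using (Bool; true; false; _∧_; _∨_; _xor_; not; if_then_else_)
open import Data.Bool.Properties using (∧-zeroʳ; ∧-identityʳ; ∧-assoc; xor-identityʳ)
open import Data.Nat
open import Data.Nat.Properties
open import Data.Nat.DivMod
open import Data.Nat.Divisibility using (m∣m*n)
open import Data.Fin using (Fin; inject₁; fromℕ<)
import Data.Fin as F
import Data.Fin.Properties as Finₚ
open import Data.Product using (Σ-syntax; _×_; _,_; proj₁; proj₂)
open import Data.Sum using (_⊎_; inj₁; inj₂)
open import Function using (_∘_)
open import Relation.Binary.PropositionalEquality
open import Relation.Nullary using (contradiction)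
open import Relation.Nullary.Decidable using (yes; no; dec-true; dec-false)

var-suc : ∀ {m} (x : Fin (suc m) → Bool) t → var x (suc t) ≡ var (x ∘ F.suc) t
var-suc {m} x t with suc t <? suc m | t <? m
... | yes _   | yes _   = refl
... | yes t<m | no t≮m  = contradiction (<-pred t<m) t≮m
... | no t≮m  | yes t<m = contradiction (s<s t<m) t≮m
... | no _    | no _    = refl

var≡true⇒< : ∀ {m} (x : Fin m → Bool) t → var x t ≡ true → t < m
var≡true⇒< {m} x t e with t <? m
... | yes t<m = t<m
... | no _    = contradiction e λ ()

var-inject₁ : ∀ {n} (x : Fin (suc n) → Bool) t → t < n → var (x ∘ inject₁) t ≡ var x t
var-inject₁ {n} x t t<n with t <? n | t <? suc n
... | yes p | yes q = cong x (Finₚ.toℕ-injective (begin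
  F.toℕ (inject₁ (fromℕ< p)) ≡⟨ Finₚ.toℕ-inject₁ (fromℕ< p) ⟩
  F.toℕ (fromℕ< p)           ≡⟨ Finₚ.toℕ-fromℕ< p ⟩
  t                          ≡⟨ Finₚ.toℕ-fromℕ< q ⟨
  F.toℕ (fromℕ< q)           ∎))
  where open ≡-Reasoning
... | yes p | no t≮1+n = contradiction (m<n⇒m<1+n p) t≮1+n
... | no t≮n | _       = contradiction t<n t≮n

prodF2-suc : ∀ N f → prodF2 (suc N) f ≡ f 0 ∧ prodF2 N (f ∘ suc)
prodF2-suc zero    f = sym (∧-identityʳ (f 0))
prodF2-suc (suc N) f = begin
  prodF2 (suc N) f ∧ f (suc N)              ≡⟨ cong (_∧ f (suc N)) (prodF2-suc N f) ⟩
  (f 0 ∧ prodF2 N (f ∘ suc)) ∧ f (suc N)    ≡⟨ ∧-assoc (f 0) _ _ ⟩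
  f 0 ∧ (prodF2 N (f ∘ suc) ∧ f (suc N))    ∎
  where open ≡-Reasoning

prodF2-cong : ∀ N {f g} → (∀ i → i < N → f i ≡ g i) → prodF2 N f ≡ prodF2 N g
prodF2-cong zero    f≗g = refl
prodF2-cong (suc N) f≗g = cong₂ _∧_ (prodF2-cong N (λ i i<N → f≗g i (m<n⇒m<1+n i<N))) (f≗g N ≤-refl)

sumF2-zero : ∀ N {f} → (∀ i → i < N → f i ≡ false) → sumF2 N f ≡ false
sumF2-zero zero    f≡0 = refl
sumF2-zero (suc N) f≡0 = cong₂ _xor_ (sumF2-zero N (λ i i<N → f≡0 i (m<n⇒m<1+n i<N))) (f≡0 N ≤-refl)

sumF2-single : ∀ N {f i₀} → i₀ < N → (∀ i → i < N → i ≢ i₀ → f i ≡ false) → sumF2 N f ≡ f i₀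
sumF2-single (suc N) {f} i₀<1+N f≡0 with m<1+n⇒m<n∨m≡n i₀<1+N
... | inj₁ i₀<N = begin
  sumF2 N f xor f N   ≡⟨ cong₂ _xor_ (sumF2-single N i₀<N (λ i i<N → f≡0 i (m<n⇒m<1+n i<N)))
                                     (f≡0 N ≤-refl (>⇒≢ i₀<N)) ⟩
  f _ xor false       ≡⟨ xor-identityʳ _ ⟩
  f _                 ∎
  where open ≡-Reasoning
... | inj₂ refl = cong (_xor f N) (sumF2-zero N (λ i i<N → f≡0 i (m<n⇒m<1+n i<N) (<⇒≢ i<N)))

leadingOne : ∀ {m} → (Fin m → Bool) → ℕ → Bool
leadingOne x t = prodF2 t (λ s → true xor var x s) ∧ var x t

leadingOne-suc : ∀ {m} (x : Fin (suc m) → Bool) t →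
                 leadingOne x (suc t) ≡ not (x F.zero) ∧ leadingOne (x ∘ F.suc) t
leadingOne-suc x t = begin
  prodF2 (suc t) (λ s → not (var x s)) ∧ var x (suc t)
    ≡⟨ cong₂ _∧_ (prodF2-suc t _) (var-suc x t) ⟩
  (not (x F.zero) ∧ prodF2 t (λ s → not (var x (suc s)))) ∧ var (x ∘ F.suc) t
    ≡⟨ cong (λ p → (not (x F.zero) ∧ p) ∧ var (x ∘ F.suc) t)
            (prodF2-cong t (λ s _ → cong not (var-suc x s))) ⟩
  (not (x F.zero) ∧ prodF2 t (λ s → not (var (x ∘ F.suc) s))) ∧ var (x ∘ F.suc) t
    ≡⟨ ∧-assoc (not (x F.zero)) _ _ ⟩
  not (x F.zero) ∧ leadingOne (x ∘ F.suc) t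
    ∎
  where open ≡-Reasoning

argmax-head : ∀ {m} (x : Fin (suc m) → Bool) →
  argmax x ≡ (if x F.zero then 0 else if maxF2 (x ∘ F.suc) then suc (argmax (x ∘ F.suc)) else 0)
argmax-head x = unfold (x F.zero) (maxF2 (x ∘ F.suc))
  where
  -- the left-hand side is argmax x unfolded, with x 0 and the maximum of the tail generalised
  unfold : ∀ b M →
    (if b == (b ∨ M) then 0 else suc (leastIdx (λ i → x (F.suc i) == (b ∨ M))))
      ≡ (if b then 0 else if M then suc (leastIdx (λ i → x (F.suc i) == M)) else 0)
  unfold true  M     = refl
  unfold false false = refl
  unfold false true  = refl

leadingOne≡indicator : ∀ {m} (x : Fin m → Bool) t → leadingOne x t ≡ maxF2 x ∧ (t ≡ᵇ argmax x)
leadingOne≡indicator {zero} x t with t <? 0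
... | no _ = ∧-zeroʳ _
leadingOne≡indicator {suc m} x zero rewrite argmax-head x with x F.zero | maxF2 (x ∘ F.suc)
... | true  | _     = refl
... | false | false = refl
... | false | true  = refl
leadingOne≡indicator {suc m} x (suc t)
  rewrite leadingOne-suc x t | leadingOne≡indicator (x ∘ F.suc) t | argmax-head x
  with x F.zero | maxF2 (x ∘ F.suc)
... | true  | _     = refl
... | false | false = refl
... | false | true  = refl

leadingOne-argmax : ∀ {m} (x : Fin m → Bool) → leadingOne x (argmax x) ≡ maxF2 x
leadingOne-argmax x = trans (leadingOne≡indicator x (argmax x))
                            (trans (cong (maxF2 x ∧_) (dec-true (argmax x ≟ argmax x) refl)) (∧-identityʳ _))

leadingOne-≢ : ∀ {m} (x : Fin m → Bool) {t} → t ≢ argmax x → leadingOne x t ≡ false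
leadingOne-≢ x {t} t≢a = trans (leadingOne≡indicator x t)
                               (trans (cong (maxF2 x ∧_) (dec-false (t ≟ argmax x) t≢a)) (∧-zeroʳ _))

leadingOne-allZero : ∀ {m} (x : Fin m → Bool) t → maxF2 x ≡ false → leadingOne x t ≡ false
leadingOne-allZero x t e = trans (leadingOne≡indicator x t) (cong (_∧ (t ≡ᵇ argmax x)) e)

leadingOne⇒argmax : ∀ {m} (x : Fin m → Bool) {t} → leadingOne x t ≡ true → t ≡ argmax x
leadingOne⇒argmax x {t} e with t ≟ argmax x
... | yes t≡a = t≡a
... | no t≢a  = contradiction (trans (sym e) (leadingOne-≢ x t≢a)) λ ()

leadingOne⇒var : ∀ {m} (x : Fin m → Bool) t → leadingOne x t ≡ true → var x t ≡ true
leadingOne⇒var x t e with var x t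
... | true  = refl
... | false = trans (sym (∧-zeroʳ _)) e

leadingOne-inject₁ : ∀ {n} (x : Fin (suc n) → Bool) t → t < n →
                     leadingOne (x ∘ inject₁) t ≡ leadingOne x t
leadingOne-inject₁ x t t<n = cong₂ _∧_
  (prodF2-cong t (λ s s<t → cong not (var-inject₁ x s (<-trans s<t t<n))))
  (var-inject₁ x t t<n)

argmax-allZero : ∀ {m} (x : Fin m → Bool) → maxF2 x ≡ false → argmax x ≡ 0
argmax-allZero {zero}  x _ = refl
argmax-allZero {suc m} x e rewrite argmax-head x with x F.zero | maxF2 (x ∘ F.suc)
argmax-allZero {suc m} x () | true  | _
argmax-allZero {suc m} x _  | false | false = refl

argmax< : ∀ {m} (x : Fin m → Bool) → maxF2 x ≡ true → argmax x < m
argmax< x e = var≡true⇒< x (argmax x) (leadingOne⇒var x (argmax x) (trans (leadingOne-argmax x) e))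

argmax≤ : ∀ {n} (x : Fin (suc n) → Bool) → argmax x ≤ n
argmax≤ {n} x = byMax (maxF2 x) refl
  where
  byMax : ∀ b → maxF2 x ≡ b → argmax x ≤ n
  byMax true  e = ≤-pred (argmax< x e)
  byMax false e = subst (_≤ n) (sym (argmax-allZero x e)) z≤n

argmax-inject₁ : ∀ {n} (x : Fin (suc n) → Bool) →
  argmax x ≡ argmax (x ∘ inject₁) ⊎ (argmax x ≡ n × argmax (x ∘ inject₁) ≡ 0)
argmax-inject₁ {n} x = byMax (maxF2 (x ∘ inject₁)) (maxF2 x) refl refl
  where
  y = x ∘ inject₁
  byMax : ∀ b c → maxF2 y ≡ b → maxF2 x ≡ c →
          argmax x ≡ argmax y ⊎ (argmax x ≡ n × argmax y ≡ 0)
  byMax true  _     ey _  = inj₁ (sym (leadingOne⇒argmax x (begin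
    leadingOne x (argmax y) ≡⟨ leadingOne-inject₁ x (argmax y) (argmax< y ey) ⟨
    leadingOne y (argmax y) ≡⟨ leadingOne-argmax y ⟩
    maxF2 y                 ≡⟨ ey ⟩
    true                    ∎)))
    where open ≡-Reasoning
  byMax false false ey ex = inj₁ (trans (argmax-allZero x ex) (sym (argmax-allZero y ey)))
  byMax false true  ey ex with m<1+n⇒m<n∨m≡n (argmax< x ex)
  ... | inj₂ a≡n = inj₂ (a≡n , argmax-allZero y ey)
  ... | inj₁ a<n = contradiction (begin
    true                    ≡⟨ ex ⟨
    maxF2 x                 ≡⟨ leadingOne-argmax x ⟨
    leadingOne x (argmax x) ≡⟨ leadingOne-inject₁ x (argmax x) a<n ⟨
    leadingOne y (argmax x) ≡⟨ leadingOne-allZero y (argmax x) ey ⟩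
    false                   ∎) λ ()
    where open ≡-Reasoning

digit-zero : ∀ r → digit r 0 ≡ false
digit-zero zero    = refl
digit-zero (suc r) = digit-zero r

digit0-even : ∀ q b → digit 0 (2 * q + b) ≡ digit 0 b
digit0-even q b = cong (λ a → if a ≡ᵇ 1 then true else false) (%-remove-+ˡ b (m∣m*n q))

[n*m+o]/n≡m+o/n : ∀ n m o .{{_ : NonZero n}} → (n * m + o) / n ≡ m + o / n
[n*m+o]/n≡m+o/n n m o = begin
  (n * m + o) / n    ≡⟨ +-distrib-/-∣ˡ o (m∣m*n m) ⟩
  n * m / n + o / n  ≡⟨ cong (λ a → a / n + o / n) (*-comm n m) ⟩
  m * n / n + o / n  ≡⟨ cong (_+ o / n) (m*n/n≡m m n) ⟩
  m + o / n          ∎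
  where open ≡-Reasoning

half< : ∀ u s → s < 2 * u → s / 2 < u
half< u s s<2u = m<n*o⇒m/o<n (subst (s <_) (*-comm 2 u) s<2u)

digit-lowerHalf : ∀ r q s → s < 2 ^ r → digit r (2 ^ (r + 1) * q + s) ≡ false
digit-lowerHalf zero    q zero _   = digit0-even q 0
digit-lowerHalf zero    q (suc s) (s≤s ())
digit-lowerHalf (suc r) q s    s<u = begin
  digit r ((2 * 2 ^ (r + 1) * q + s) / 2)  ≡⟨ cong (λ a → digit r ((a + s) / 2)) (*-assoc 2 (2 ^ (r + 1)) q) ⟩
  digit r ((2 * (2 ^ (r + 1) * q) + s) / 2) ≡⟨ cong (digit r) ([n*m+o]/n≡m+o/n 2 _ s) ⟩
  digit r (2 ^ (r + 1) * q + s / 2)        ≡⟨ digit-lowerHalf r q (s / 2) (half< (2 ^ r) s s<u) ⟩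
  false                                    ∎
  where open ≡-Reasoning

digit-upperHalf : ∀ r q s → s < 2 ^ r → digit r (2 ^ (r + 1) * q + 2 ^ r + s) ≡ true
digit-upperHalf zero    q zero _   = trans (cong (digit 0) (+-assoc (2 * q) 1 0)) (digit0-even q 1)
digit-upperHalf zero    q (suc s) (s≤s ())
digit-upperHalf (suc r) q s    s<u = begin
  digit r ((2 * 2 ^ (r + 1) * q + 2 * 2 ^ r + s) / 2)   ≡⟨ cong (λ a → digit r ((a + s) / 2)) double ⟩
  digit r ((2 * (2 ^ (r + 1) * q + 2 ^ r) + s) / 2)     ≡⟨ cong (digit r) ([n*m+o]/n≡m+o/n 2 _ s) ⟩
  digit r (2 ^ (r + 1) * q + 2 ^ r + s / 2)             ≡⟨ digit-upperHalf r q (s / 2) (half< (2 ^ r) s s<u) ⟩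
  true                                                  ∎
  where
  open ≡-Reasoning
  double : 2 * 2 ^ (r + 1) * q + 2 * 2 ^ r ≡ 2 * (2 ^ (r + 1) * q + 2 ^ r)
  double = trans (cong (_+ 2 * 2 ^ r) (*-assoc 2 (2 ^ (r + 1)) q)) (sym (*-distribˡ-+ 2 (2 ^ (r + 1) * q) (2 ^ r)))

digit-lowerHalf-range : ∀ r k n → 2 ^ (r + 1) * k ≤ n → n < 2 ^ (r + 1) * k + 2 ^ r → digit r n ≡ false
digit-lowerHalf-range r k n Uk≤n n<Uk+u =
  subst (λ m → digit r m ≡ false) Uk+s≡n (digit-lowerHalf r k (n ∸ 2 ^ (r + 1) * k)
    (+-cancelˡ-< (2 ^ (r + 1) * k) _ _ (subst (_< 2 ^ (r + 1) * k + 2 ^ r) (sym Uk+s≡n) n<Uk+u)))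
  where
  Uk+s≡n : 2 ^ (r + 1) * k + (n ∸ 2 ^ (r + 1) * k) ≡ n
  Uk+s≡n = m+[n∸m]≡n Uk≤n

*+-injective : ∀ n {q q′ o o′} .{{_ : NonZero n}} → o < n → o′ < n →
               n * q + o ≡ n * q′ + o′ → q ≡ q′ × o ≡ o′
*+-injective n {q} {q′} {o} {o′} o<n o′<n eq =
  q≡q′ , +-cancelˡ-≡ (n * q) o o′ (trans eq (cong (λ p → n * p + o′) (sym q≡q′)))
  where
  quotient : ∀ {p r} → r < n → (n * p + r) / n ≡ p
  quotient {p} {r} r<n = trans ([n*m+o]/n≡m+o/n n p r) (trans (cong (p +_) (m<n⇒m/n≡0 r<n)) (+-identityʳ p))
  q≡q′ : q ≡ q′
  q≡q′ = trans (sym (quotient o<n)) (trans (cong (_/ n) eq) (quotient o′<n))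

m<1+[n∸1]⊓o⇒m<n : ∀ {m n o} → 0 < n → m < suc ((n ∸ 1) ⊓ o) → m < n
m<1+[n∸1]⊓o⇒m<n {n = suc n} _ (s≤s m≤) = s≤s (≤-trans m≤ (m⊓n≤m n _))

m<n⇒m≤o⇒m<1+[n∸1]⊓o : ∀ {m n o} → m < n → m ≤ o → m < suc ((n ∸ 1) ⊓ o)
m<n⇒m≤o⇒m<1+[n∸1]⊓o (s≤s m≤n∸1) m≤o = s≤s (⊓-glb m≤n∸1 m≤o)

m≡n*[m/n]+m%n : ∀ m n .{{_ : NonZero n}} → m ≡ n * (m / n) + m % n
m≡n*[m/n]+m%n m n = trans (m≡m%n+[m/n]*n m n) (trans (+-comm (m % n) _) (cong (_+ m % n) (*-comm (m / n) n)))

2^[r+1]≡2^r+2^r : ∀ r → 2 ^ (r + 1) ≡ 2 ^ r + 2 ^ r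
2^[r+1]≡2^r+2^r r = trans (cong (2 ^_) (+-comm r 1)) (cong (2 ^ r +_) (+-identityʳ (2 ^ r)))

module _ (r : ℕ) where

  private
    U u : ℕ
    U = 2 ^ (r + 1)
    u = 2 ^ r

    instance
      U≢0 : NonZero U
      U≢0 = m^n≢0 2 (r + 1)

  blockDecomposition : ∀ a → Σ[ q ∈ ℕ ] Σ[ s ∈ ℕ ] s < 2 ^ r ×
    (a ≡ 2 ^ (r + 1) * q + s ⊎ a ≡ 2 ^ (r + 1) * q + 2 ^ r + s)
  blockDecomposition a with a % U <? u
  ... | yes w<u = a / U , a % U , w<u , inj₁ (m≡n*[m/n]+m%n a U)
  ... | no w≮u  = a / U , a % U ∸ u , s<u , inj₂ (begin
    a                               ≡⟨ m≡n*[m/n]+m%n a U ⟩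
    U * (a / U) + a % U             ≡⟨ cong (U * (a / U) +_) u+s≡w ⟨
    U * (a / U) + (u + (a % U ∸ u)) ≡⟨ +-assoc (U * (a / U)) u _ ⟨
    U * (a / U) + u + (a % U ∸ u)   ∎)
    where
    open ≡-Reasoning
    u+s≡w : u + (a % U ∸ u) ≡ a % U
    u+s≡w = m+[n∸m]≡n (≮⇒≥ w≮u)
    s<u : a % U ∸ u < u
    s<u = +-cancelˡ-< u _ _ (subst₂ _<_ (sym u+s≡w) (2^[r+1]≡2^r+2^r r) (m%n<n a U))

  blockSum : ℕ → ℕ → (ℕ → Bool) → Bool
  blockSum n k g =
    sumF2 (suc k) (λ j →
      sumF2 (suc ((2 ^ r ∸ 1) ⊓ (n ∸ 2 ^ (r + 1) * j ∸ 2 ^ r))) (λ i →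
        g (2 ^ (r + 1) * j + 2 ^ r + i)))

  private
    u≤U : u ≤ U
    u≤U = subst (u ≤_) (sym (2^[r+1]≡2^r+2^r r)) (m≤m+n u u)

    u+<U : ∀ {i} → i < u → u + i < U
    u+<U {i} i<u = subst (u + i <_) (sym (2^[r+1]≡2^r+2^r r)) (+-monoʳ-< u i<u)

    blockIndex-injective : ∀ {j i q w} → i < u → w < U → U * j + u + i ≡ U * q + w → j ≡ q × u + i ≡ w
    blockIndex-injective {j} {i} i<u w<U eq = *+-injective U (u+<U i<u) w<U (trans (sym (+-assoc (U * j) u i)) eq)

    inBlock⇒<u : ∀ n j {i} → i < suc ((u ∸ 1) ⊓ (n ∸ U * j ∸ u)) → i < u
    inBlock⇒<u n j = m<1+[n∸1]⊓o⇒m<n (m^n>0 2 r)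

  blockSum-lowerHalf : ∀ n k q {s} (g : ℕ → Bool) → s < 2 ^ r →
                       (∀ t → t ≢ 2 ^ (r + 1) * q + s → g t ≡ false) → blockSum n k g ≡ false
  blockSum-lowerHalf n k q {s} g s<u g-supp =
    sumF2-zero (suc k) (λ j _ → sumF2-zero _ (λ i i<B → g-supp _ (miss j (inBlock⇒<u n j i<B))))
    where
    miss : ∀ j {i} → i < u → U * j + u + i ≢ U * q + s
    miss j {i} i<u eq = <⇒≱ s<u (subst (u ≤_) (proj₂ (blockIndex-injective i<u (<-≤-trans s<u u≤U) eq)) (m≤m+n u i))

  blockSum-upperHalf : ∀ n k q {s} (g : ℕ → Bool) → s < 2 ^ r →
                       2 ^ (r + 1) * q + 2 ^ r + s ≤ n → n < 2 ^ (r + 1) * suc k →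
                       (∀ t → t ≢ 2 ^ (r + 1) * q + 2 ^ r + s → g t ≡ false) →
                       blockSum n k g ≡ g (2 ^ (r + 1) * q + 2 ^ r + s)
  blockSum-upperHalf n k q {s} g s<u a≤n n<U[1+k] g-supp = begin
    blockSum n k g
      ≡⟨ sumF2-single (suc k) q<1+k (λ j _ j≢q →
           sumF2-zero _ (λ i i<B → g-supp _ (j≢q ∘ proj₁ ∘ hit j (inBlock⇒<u n j i<B)))) ⟩
    sumF2 (suc ((u ∸ 1) ⊓ (n ∸ U * q ∸ u))) (λ i → g (U * q + u + i))
      ≡⟨ sumF2-single _ s∈B (λ i i<B i≢s →
           g-supp _ (i≢s ∘ +-cancelˡ-≡ u i s ∘ proj₂ ∘ hit q (inBlock⇒<u n q i<B))) ⟩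
    g (U * q + u + s)
      ∎
    where
    open ≡-Reasoning
    hit : ∀ j {i} → i < u → U * j + u + i ≡ U * q + u + s → j ≡ q × u + i ≡ u + s
    hit j i<u eq = blockIndex-injective i<u (u+<U s<u) (trans eq (+-assoc (U * q) u s))
    q<1+k : q < suc k
    q<1+k = *-cancelˡ-< U q (suc k) (≤-<-trans (≤-trans (m≤m+n (U * q) u) (m≤m+n _ s)) (≤-<-trans a≤n n<U[1+k]))
    rearrange : U * q + u + s ≡ s + u + U * q
    rearrange = trans (+-comm (U * q + u) s) (trans (cong (s +_) (+-comm (U * q) u)) (sym (+-assoc s u (U * q))))
    s∈B : s < suc ((u ∸ 1) ⊓ (n ∸ U * q ∸ u))
    s∈B = m<n⇒m≤o⇒m<1+[n∸1]⊓o s<u (m+n≤o⇒m≤o∸n s (m+n≤o⇒m≤o∸n (s + u) (subst (_≤ n) rearrange a≤n)))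

  blockSum-supported : ∀ n k {a} (g : ℕ → Bool) → a ≤ n → n < 2 ^ (r + 1) * suc k →
                       (∀ t → t ≢ a → g t ≡ false) → blockSum n k g ≡ g a ∧ digit r a
  blockSum-supported n k {a} g a≤n n<U[1+k] g-supp with blockDecomposition a
  ... | q , s , s<u , inj₁ refl = begin
    blockSum n k g   ≡⟨ blockSum-lowerHalf n k q g s<u g-supp ⟩
    false            ≡⟨ ∧-zeroʳ (g a) ⟨
    g a ∧ false      ≡⟨ cong (g a ∧_) (digit-lowerHalf r q s s<u) ⟨
    g a ∧ digit r a  ∎
    where open ≡-Reasoning
  ... | q , s , s<u , inj₂ refl = begin
    blockSum n k g   ≡⟨ blockSum-upperHalf n k q g s<u a≤n n<U[1+k] g-supp ⟩
    g a              ≡⟨ ∧-identityʳ (g a) ⟨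
    g a ∧ true       ≡⟨ cong (g a ∧_) (digit-upperHalf r q s s<u) ⟨
    g a ∧ digit r a  ∎
    where open ≡-Reasoning

argmaxDigit-singleton : ∀ r (x : Fin 1 → Bool) → argmaxDigit r x ≡ false
argmaxDigit-singleton r x = trans (cong (digit r) (n≤0⇒n≡0 (argmax≤ x))) (digit-zero r)

maxF2-∧-argmaxDigit : ∀ r {m} (x : Fin m → Bool) → maxF2 x ∧ argmaxDigit r x ≡ argmaxDigit r x
maxF2-∧-argmaxDigit r x = byMax (maxF2 x) refl
  where
  byMax : ∀ b → maxF2 x ≡ b → maxF2 x ∧ argmaxDigit r x ≡ argmaxDigit r x
  byMax true  e = cong (_∧ argmaxDigit r x) e
  byMax false e = begin
    maxF2 x ∧ argmaxDigit r x ≡⟨ cong (_∧ argmaxDigit r x) e ⟩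
    false                     ≡⟨ digit-zero r ⟨
    digit r 0                 ≡⟨ cong (digit r) (argmax-allZero x e) ⟨
    argmaxDigit r x           ∎
    where open ≡-Reasoning

argmaxDigit≡blockSum : ∀ r n k → n < 2 ^ (r + 1) * suc k → (x : Fin (suc n) → Bool) →
                       argmaxDigit r x ≡ blockSum r n k (leadingOne x)
argmaxDigit≡blockSum r n k n<U[1+k] x = sym (begin
  blockSum r n k (leadingOne x)              ≡⟨ blockSum-supported r n k (leadingOne x) (argmax≤ x) n<U[1+k]
                                                                  (λ _ → leadingOne-≢ x) ⟩
  leadingOne x (argmax x) ∧ argmaxDigit r x  ≡⟨ cong (_∧ argmaxDigit r x) (leadingOne-argmax x) ⟩
  maxF2 x ∧ argmaxDigit r x                  ≡⟨ maxF2-∧-argmaxDigit r x ⟩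
  argmaxDigit r x                            ∎)
  where open ≡-Reasoning

argmaxDigit-inject₁ : ∀ r n → digit r n ≡ false → (x : Fin (suc n) → Bool) →
                      argmaxDigit r x ≡ argmaxDigit r (x ∘ inject₁)
argmaxDigit-inject₁ r n digit[n]≡0 x with argmax-inject₁ x
... | inj₁ a≡a′         = cong (digit r) a≡a′
... | inj₂ (a≡n , a′≡0) = begin
  digit r (argmax x)              ≡⟨ cong (digit r) a≡n ⟩
  digit r n                       ≡⟨ digit[n]≡0 ⟩
  false                           ≡⟨ digit-zero r ⟨
  digit r 0                       ≡⟨ cong (digit r) a′≡0 ⟨
  digit r (argmax (x ∘ inject₁))  ∎
  where open ≡-Reasoning

proposition4p4 : (∀ (r : ℕ) (x : Fin 1 → Bool) → argmaxDigit r x ≡ false)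
    ×
    (∀ (r n k : ℕ) → 2 ^ (r + 1) * k + 2 ^ r ≤ n → n < 2 ^ (r + 1) * (k + 1) →
      ∀ (x : Fin (suc n) → Bool) →
        argmaxDigit r x
          ≡ sumF2 (suc k) (λ j →
              sumF2 (suc ((2 ^ r ∸ 1) ⊓ (n ∸ 2 ^ (r + 1) * j ∸ 2 ^ r))) (λ i →
                prodF2 (2 ^ (r + 1) * j + 2 ^ r + i) (λ t → true xor var x t)
                  ∧ var x (2 ^ (r + 1) * j + 2 ^ r + i))))
    ×
    (∀ (r n k : ℕ) → 1 ≤ n → 2 ^ (r + 1) * k ≤ n → n < 2 ^ (r + 1) * k + 2 ^ r →
      ∀ (x : Fin (suc n) → Bool) →
        argmaxDigit r x ≡ argmaxDigit r (x ∘ inject₁))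
proposition4p4 =
    argmaxDigit-singleton
  , (λ r n k _ n<U[k+1] →
       argmaxDigit≡blockSum r n k (subst (λ m → n < 2 ^ (r + 1) * m) (+-comm k 1) n<U[k+1]))
  , (λ r n k _ Uk≤n n<Uk+u →
       argmaxDigit-inject₁ r n (digit-lowerHalf-range r k n Uk≤n n<Uk+u))
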